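{- For all integers $r,s\ge 2$, $\chi_{la}\big((2r+1)[(2s+1)P_2\vee O_2]\big)=3$.
   Context: For a graph $G$ with $q$ edges, a bijection $f:E(G)\to\{1,\dots,q\}$ is a local antimagic labeling if $f^+(u)\neq f^+(v)$ for every edge $uv$, where $f^+(u)$ is the sum of the labels of edges incident to $u$; $\chi_{la}(G)$ is the minimum number of distinct values of $f^+$ over all local antimagic labelings of $G$. $O_m$ is the null graph on $m$ vertices, $aP_2$ is the disjoint union of $a$ copies of $P_2$ (a single edge), $G\vee H$ is the join of $G$ and $H$, and $mG$ (here written $(2r+1)[\,\cdot\,]$) denotes the disjoint union of $m$ copies of $G$. -}

module Defs where

open import Data.Nat using (ℕ; zero; suc; _+_; _*_; _≤_)
open import Data.Nat.Properties using () renaming (_≟_ to _≟ℕ_)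
open import Data.Fin using (Fin; zero; suc; toℕ; _↑ˡ_; _↑ʳ_; splitAt; remQuot)
open import Data.Fin.Properties using () renaming (_≟_ to _≟F_)
open import Data.Fin.Permutation using (Permutation′; _⟨$⟩ʳ_)
open import Data.Product using (_×_; _,_; proj₁; proj₂; Σ)
open import Data.Sum using (inj₁; inj₂)
open import Data.Bool using (Bool; _∨_; if_then_else_)
open import Data.List using (List; map; allFin; length; deduplicate)
open import Data.Nat.ListAction using (sum)
open import Relation.Nullary using (¬_)
open import Relation.Nullary.Decidable using (⌊_⌋)
open import Relation.Binary.PropositionalEquality using (_≡_)

record Graph : Set where
  field
    V    : ℕ
    E    : ℕ
    ends : Fin E → Fin V × Fin V
open Graph public

O : ℕ → Graph
O k = record { V = k ; E = 0 ; ends = λ () }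

P₂ : Graph
P₂ = record { V = 2 ; E = 1 ; ends = λ _ → (zero , suc zero) }

_⊕_ : Graph → Graph → Graph
G ⊕ H = record
  { V = V G + V H
  ; E = E G + E H
  ; ends = λ e → f (splitAt (E G) e)
  }
  where
  f : _ → Fin (V G + V H) × Fin (V G + V H)
  f (inj₁ e) = (proj₁ (ends G e) ↑ˡ V H) , (proj₂ (ends G e) ↑ˡ V H)
  f (inj₂ e) = (V G ↑ʳ proj₁ (ends H e)) , (V G ↑ʳ proj₂ (ends H e))

_∨ᴳ_ : Graph → Graph → Graph
G ∨ᴳ H = record
  { V = V G + V H
  ; E = E (G ⊕ H) + V G * V H
  ; ends = λ e → f (splitAt (E (G ⊕ H)) e)
  }
  where
  f : _ → Fin (V G + V H) × Fin (V G + V H)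
  f (inj₁ e) = ends (G ⊕ H) e
  f (inj₂ p) = (proj₁ (remQuot {V G} (V H) p) ↑ˡ V H) , (V G ↑ʳ proj₂ (remQuot {V G} (V H) p))

copies : ℕ → Graph → Graph
copies zero    G = O 0
copies (suc m) G = G ⊕ copies m G

label : (G : Graph) → Permutation′ (E G) → Fin (E G) → ℕ
label G π e = suc (toℕ (π ⟨$⟩ʳ e))

incident : (G : Graph) → Fin (V G) → Fin (E G) → Bool
incident G u e = ⌊ proj₁ (ends G e) ≟F u ⌋ ∨ ⌊ proj₂ (ends G e) ≟F u ⌋

vsum : (G : Graph) → Permutation′ (E G) → Fin (V G) → ℕ
vsum G π u = sum (map (λ e → if incident G u e then label G π e else 0) (allFin (E G)))

LocalAntimagic : (G : Graph) → Permutation′ (E G) → Set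
LocalAntimagic G π = ∀ e → ¬ (vsum G π (proj₁ (ends G e)) ≡ vsum G π (proj₂ (ends G e)))

numValues : (G : Graph) → Permutation′ (E G) → ℕ
numValues G π = length (deduplicate _≟ℕ_ (map (vsum G π) (allFin (V G))))

ChiLaIs : Graph → ℕ → Set
ChiLaIs G k =
  Σ (Permutation′ (E G)) (λ π → LocalAntimagic G π × numValues G π ≡ k)
  × (∀ (π : Permutation′ (E G)) → LocalAntimagic G π → k ≤ numValues G π)

{-# OPTIONS --safe #-}
-- Let M = 2r + 1 and N = 2s + 1. In the k-th copy of (2s+1)P₂ ∨ O₂, label the edge of type a
-- (x_j y_j, or one of x_j u, x_j v, y_j u, y_j v) of the j-th path by 1 + c, where c has the
-- digits (digit a, σ, τ) in the mixed radix (5, M, N); so the labels are exactly 1, …, 5MN.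
-- The values of τ come from a 3 × N magic rectangle (three permutations of {0, …, 2s} with all
-- column sums 3s), and those of σ from a 3 × M one, the three edges at x_j (and at y_j) using
-- its three rows. Hence f⁺ takes one value on all x_j and one on all y_j, with digit sums 3
-- and 9. At the hub u the rows are cyclically shifted along the paths 0, 1, 2 and used in
-- complementary pairs (i, 2r − i) along the remaining 2s − 2 paths, so f⁺(u) does not depend
-- on k, and f⁺(v) = f⁺(u) term by term. These three values are distinct. Conversely x₀ y₀ u
-- is a triangle, so every local antimagic labelling has at least three vertex sums.

module Submission where

open import Defs
open import Data.Nat.Properties
  using (+-*-semiring; +-assoc; +-identityʳ; +-identityˡ; +-suc; +-cancelˡ-≡; +-cancelʳ-≡; *-cancelˡ-≡; ∸-cancelˡ-≡;
         m+[n∸m]≡n; m∸n≤m; even≢odd; ≤-reflexive; ≤-trans; ≤-antisym; ≤-pred; <-trans; <⇒≢; >⇒≢; ≰⇒>; n≮n;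
         m≤m+n; m≤n+m; m<m+n; m+n≤o⇒m≤o; *-monoʳ-≤; ≤ᵇ⇒≤; ≤⇒≤ᵇ; module ≤-Reasoning)
  renaming (_≟_ to _≟ℕ_)
import Data.Nat.Properties as ℕ
open import Algebra.Properties.Semiring.Sum +-*-semiring
  using (sum; sum-syntax; sum-cong-≗; sum-replicate-zero; ∑-distrib-+; *-distribˡ-sum)
open import Data.Bool using (Bool; true; false; _∨_; if_then_else_; T)
open import Data.Bool.Properties using (∨-zeroʳ)
open import Data.Fin
  using (Fin; zero; suc; toℕ; fromℕ; fromℕ<; inject₁; punchOut; _↑ˡ_; _↑ʳ_; splitAt; combine; remQuot)
open import Data.Fin.Permutation using (Permutation′; _⟨$⟩ʳ_; permutation)
open import Data.Fin.Properties
  using (suc-injective; toℕ-injective; toℕ<n; toℕ-fromℕ<; fromℕ<-injective; fromℕ≢inject₁; ↑ˡ-injective; ↑ʳ-injective;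
         splitAt-↑ˡ; splitAt-↑ʳ; splitAt⁻¹-↑ˡ; splitAt⁻¹-↑ʳ; toℕ-combine; combine-injective; combine-surjective; remQuot-combine;
         injective⇒≤; any?; punchOut-injective)
  renaming (_≟_ to _≟ᶠ_)
open import Data.List using (List; _∷_; []; map; allFin; tabulate; length; lookup; deduplicate)
open import Data.List.Properties using (map-tabulate)
open import Data.List.Membership.Propositional using (_∈_)
open import Data.List.Membership.Propositional.Properties
  using (∈-lookup; ∈-map⁺; ∈-map⁻; ∈-allFin; ∈-deduplicate⁺; ∈-deduplicate⁻)
import Data.List.Relation.Unary.All as All
open import Data.List.Relation.Unary.AllPairs using (_∷_)
open import Data.List.Relation.Unary.Any using (index)
open import Data.List.Relation.Unary.Any.Properties using (lookup-index)
open import Data.List.Relation.Unary.Unique.Propositional using (Unique)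
open import Data.List.Relation.Unary.Unique.DecPropositional.Properties using (deduplicate-!)
open import Data.Nat using (ℕ; zero; suc; _+_; _*_; _∸_; _≤_; _<_; _≤ᵇ_; s≤s; z<s)
open import Data.Nat.ListAction using () renaming (sum to sumᴸ)
open import Data.Nat.Tactic.RingSolver using (solve-∀; solve)
open import Data.Product using (_×_; _,_; proj₁; proj₂; map₁; uncurry; ∃)
import Data.Product as Product
open import Data.Product.Properties using (,-injective; ,-injectiveʳ; ×-≡,≡→≡)
open import Data.Sum using (inj₁; inj₂; [_,_]′)
open import Function using (_∘_; id; case_of_)
open import Function.Definitions using (Injective)
open import Relation.Binary.Definitions using (DecidableEquality)
open import Relation.Binary.PropositionalEquality
open import Relation.Nullary using (¬_; yes; no; contradiction)
open import Relation.Nullary.Decidable using (⌊_⌋; isYes≗does; dec-true; dec-false)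

private variable m n : ℕ

sum-zero : {f : Fin n → ℕ} → (∀ i → f i ≡ 0) → sum f ≡ 0
sum-zero {n} f≗0 = trans (sum-cong-≗ f≗0) (sum-replicate-zero n)

sum-single : {f : Fin n → ℕ} (y : Fin n) → (∀ i → ¬ i ≡ y → f i ≡ 0) → sum f ≡ f y
sum-single {f = f} zero    f≡0 =
  trans (cong (f zero +_) (sum-zero {f = f ∘ suc} λ i → f≡0 (suc i) λ ())) (+-identityʳ _)
sum-single {f = f} (suc y) f≡0 =
  trans (cong (_+ sum (f ∘ suc)) (f≡0 zero λ ())) (sum-single y λ i i≢y → f≡0 (suc i) (i≢y ∘ suc-injective))

sum-↑ : ∀ m (f : Fin (m + n) → ℕ) → sum f ≡ sum (f ∘ (_↑ˡ n)) + sum (f ∘ (m ↑ʳ_))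
sum-↑ zero    f = refl
sum-↑ (suc m) f = trans (cong (f zero +_) (sum-↑ m (f ∘ suc))) (sym (+-assoc (f zero) _ _))

sum-combine : ∀ m (f : Fin (m * n) → ℕ) → sum f ≡ ∑[ i < m ] ∑[ j < n ] f (combine i j)
sum-combine zero    f = refl
sum-combine {n} (suc m) f =
  trans (sum-↑ n f) (cong (sum (f ∘ (_↑ˡ m * n)) +_) (sum-combine m (f ∘ (n ↑ʳ_))))

sumᴸ-tabulate : ∀ n (f : Fin n → ℕ) → sumᴸ (tabulate f) ≡ sum f
sumᴸ-tabulate zero    f = refl
sumᴸ-tabulate (suc n) f = cong (f zero +_) (sumᴸ-tabulate n (f ∘ suc))

sumᴸ-allFin : ∀ n (f : Fin n → ℕ) → sumᴸ (map f (allFin n)) ≡ sum f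
sumᴸ-allFin n f = trans (cong sumᴸ (map-tabulate id f)) (sumᴸ-tabulate n f)

sum-const : ∀ n c → ∑[ i < n ] c ≡ n * c
sum-const zero    c = refl
sum-const (suc n) c = cong (c +_) (sum-const n c)

sum-periodic : ∀ t (g : ℕ → ℕ) → (∀ j → g (suc (suc j)) ≡ g j) → ∑[ j < t + t ] g (toℕ j) ≡ t * (g 0 + g 1)
sum-periodic zero    g period = refl
sum-periodic (suc t) g period = begin
  g 0 + ∑[ j < t + suc t ] g (suc (toℕ j))            ≡⟨ cong (λ n → g 0 + ∑[ j < n ] g (suc (toℕ j))) (+-suc t t) ⟩
  g 0 + (g 1 + ∑[ j < t + t ] g (suc (suc (toℕ j))))  ≡⟨ cong (λ x → g 0 + (g 1 + x)) tail-sum ⟩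
  g 0 + (g 1 + t * (g 0 + g 1))                       ≡⟨ +-assoc (g 0) (g 1) _ ⟨
  g 0 + g 1 + t * (g 0 + g 1)                         ∎
  where
  open ≡-Reasoning
  tail-sum : ∑[ j < t + t ] g (suc (suc (toℕ j))) ≡ t * (g 0 + g 1)
  tail-sum = trans (sum-cong-≗ {t + t} {λ j → g (suc (suc (toℕ j)))} (period ∘ toℕ)) (sum-periodic t g period)

⌊≟⌋-injective : (f : Fin m → Fin n) → Injective _≡_ _≡_ f → ∀ a b → ⌊ f a ≟ᶠ f b ⌋ ≡ ⌊ a ≟ᶠ b ⌋
⌊≟⌋-injective f f-inj a b with a ≟ᶠ b
... | yes refl = trans (isYes≗does (f a ≟ᶠ f a)) (dec-true (f a ≟ᶠ f a) refl)
... | no a≢b   = trans (isYes≗does (f a ≟ᶠ f b)) (dec-false (f a ≟ᶠ f b) (a≢b ∘ f-inj))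

⌊≟⌋-refl : ∀ (a : Fin n) → ⌊ a ≟ᶠ a ⌋ ≡ true
⌊≟⌋-refl a = trans (isYes≗does (a ≟ᶠ a)) (dec-true (a ≟ᶠ a) refl)

⌊≟⌋-≢ : ∀ {a b : Fin n} → ¬ a ≡ b → ⌊ a ≟ᶠ b ⌋ ≡ false
⌊≟⌋-≢ {a = a} {b} a≢b = trans (isYes≗does (a ≟ᶠ b)) (dec-false (a ≟ᶠ b) a≢b)

↑ˡ≢↑ʳ : ∀ {m n} (x : Fin m) (y : Fin n) → ¬ x ↑ˡ n ≡ m ↑ʳ y
↑ˡ≢↑ʳ {suc m} zero    y ()
↑ˡ≢↑ʳ {suc m} (suc x) y eq = ↑ˡ≢↑ʳ x y (suc-injective eq)

data Split (m n : ℕ) : Fin (m + n) → Set where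
  inˡ : (i : Fin m) → Split m n (i ↑ˡ n)
  inʳ : (j : Fin n) → Split m n (m ↑ʳ j)

split : ∀ m n i → Split m n i
split m n i with splitAt m i in eq
... | inj₁ x = subst (Split m n) (splitAt⁻¹-↑ˡ eq) (inˡ x)
... | inj₂ y = subst (Split m n) (splitAt⁻¹-↑ʳ eq) (inʳ y)

module _ (a : ℕ) {b m : ℕ} (g : Fin b → Fin m × Fin a) where

  inBlocks : Fin (a + b) → Fin (suc m) × Fin a
  inBlocks = [ (zero ,_) , map₁ suc ∘ g ]′ ∘ splitAt a

  inBlocks-↑ˡ : ∀ x → inBlocks (x ↑ˡ b) ≡ (zero , x)
  inBlocks-↑ˡ x rewrite splitAt-↑ˡ a x b = refl

  inBlocks-↑ʳ : ∀ y → inBlocks (a ↑ʳ y) ≡ map₁ suc (g y)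
  inBlocks-↑ʳ y rewrite splitAt-↑ʳ a b y = refl

  inBlocks-injective : Injective _≡_ _≡_ g → Injective _≡_ _≡_ inBlocks
  inBlocks-injective g-inj {i} {i′} eq with split a b i | split a b i′
  ... | inˡ x | inˡ x′ = cong (_↑ˡ b) (,-injectiveʳ (trans (sym (inBlocks-↑ˡ x)) (trans eq (inBlocks-↑ˡ x′))))
  ... | inˡ x | inʳ y′ = case trans (sym (inBlocks-↑ˡ x)) (trans eq (inBlocks-↑ʳ y′)) of λ ()
  ... | inʳ y | inˡ x′ = case trans (sym (inBlocks-↑ʳ y)) (trans eq (inBlocks-↑ˡ x′)) of λ ()
  ... | inʳ y | inʳ y′ =
    cong (a ↑ʳ_) (g-inj (map₁-suc-injective (trans (sym (inBlocks-↑ʳ y)) (trans eq (inBlocks-↑ʳ y′)))))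
    where
    map₁-suc-injective : ∀ {p q : Fin m × Fin a} → map₁ suc p ≡ map₁ suc q → p ≡ q
    map₁-suc-injective {_ , _} {_ , _} refl = refl

Unique-lookup-injective : ∀ {A : Set} {xs : List A} → Unique xs → Injective _≡_ _≡_ (lookup xs)
Unique-lookup-injective (x∉xs ∷ _)   {zero}  {zero}  _  = refl
Unique-lookup-injective (x∉xs ∷ _)   {zero}  {suc j} eq = contradiction eq (All.lookup x∉xs (∈-lookup j))
Unique-lookup-injective (x∉xs ∷ _)   {suc i} {zero}  eq = contradiction (sym eq) (All.lookup x∉xs (∈-lookup i))
Unique-lookup-injective (_ ∷ unique) {suc i} {suc j} eq = cong suc (Unique-lookup-injective unique eq)

module _ {A : Set} (_≟_ : DecidableEquality A) where

  ≤-length-deduplicate : ∀ {k} {xs : List A} (g : Fin k → A) → Injective _≡_ _≡_ g → (∀ i → g i ∈ xs) →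
    k ≤ length (deduplicate _≟_ xs)
  ≤-length-deduplicate {k} {xs} g g-inj g∈xs = injective⇒≤ {f = position} λ {i} {j} eq → g-inj (begin
    g i                                       ≡⟨ lookup-index (g∈dedup i) ⟩
    lookup (deduplicate _≟_ xs) (position i)  ≡⟨ cong (lookup (deduplicate _≟_ xs)) eq ⟩
    lookup (deduplicate _≟_ xs) (position j)  ≡⟨ lookup-index (g∈dedup j) ⟨
    g j                                       ∎)
    where
    open ≡-Reasoning
    g∈dedup : ∀ i → g i ∈ deduplicate _≟_ xs
    g∈dedup i = ∈-deduplicate⁺ _≟_ (g∈xs i)
    position : Fin k → Fin (length (deduplicate _≟_ xs))
    position i = index (g∈dedup i)

  length-deduplicate-≤ : ∀ {k} {xs : List A} (g : Fin k → A) → (∀ {x} → x ∈ xs → ∃ λ i → g i ≡ x) →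
    length (deduplicate _≟_ xs) ≤ k
  length-deduplicate-≤ {k} {xs} g covers = injective⇒≤ {f = preimage} λ {n} {n′} eq →
    Unique-lookup-injective (deduplicate-! _≟_ xs)
      (trans (sym (proj₂ (cover n))) (trans (cong g eq) (proj₂ (cover n′))))
    where
    cover : ∀ n → ∃ λ i → g i ≡ lookup (deduplicate _≟_ xs) n
    cover n = covers (∈-deduplicate⁻ _≟_ xs (∈-lookup n))
    preimage : Fin (length (deduplicate _≟_ xs)) → Fin k
    preimage n = proj₁ (cover n)

injective⇒surjective : ∀ {n} (f : Fin n → Fin n) → Injective _≡_ _≡_ f → ∀ y → ∃ λ x → f x ≡ y
injective⇒surjective {suc n} f f-inj y with any? (λ x → f x ≟ᶠ y)
... | yes hit = hit
... | no miss = contradiction (injective⇒≤ {f = avoid} avoid-injective) (n≮n n)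
  where
  y≢f : ∀ x → ¬ y ≡ f x
  y≢f x y≡fx = miss (x , sym y≡fx)
  avoid : Fin (suc n) → Fin n
  avoid x = punchOut (y≢f x)
  avoid-injective : Injective _≡_ _≡_ avoid
  avoid-injective eq = f-inj (punchOut-injective (y≢f _) (y≢f _) eq)

injective⇒permutation : ∀ {n} (f : Fin n → ℕ) → Injective _≡_ _≡_ f → (∀ i → f i < n) →
  ∃ λ (π : Permutation′ n) → ∀ i → toℕ (π ⟨$⟩ʳ i) ≡ f i
injective⇒permutation {n} f f-inj f<n =
  permutation g g⁻¹ (λ y → proj₂ (onto y)) (λ x → g-inj (proj₂ (onto (g x)))) , λ i → toℕ-fromℕ< (f<n i)
  where
  g : Fin n → Fin n
  g i = fromℕ< (f<n i)
  g-inj : Injective _≡_ _≡_ g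
  g-inj {i} {j} eq = f-inj (trans (sym (toℕ-fromℕ< (f<n i))) (trans (cong toℕ eq) (toℕ-fromℕ< (f<n j))))
  onto : ∀ y → ∃ λ x → g x ≡ y
  onto = injective⇒surjective g g-inj
  g⁻¹ : Fin n → Fin n
  g⁻¹ y = proj₁ (onto y)

-- Weighted degrees in disjoint unions, joins and copies

meets : Fin n × Fin n → Fin n → Bool
meets (a , b) v = ⌊ a ≟ᶠ v ⌋ ∨ ⌊ b ≟ᶠ v ⌋

wdeg : (G : Graph) → (Fin (E G) → ℕ) → Fin (V G) → ℕ
wdeg G w v = ∑[ e < E G ] (if incident G v e then w e else 0)

vsum≡wdeg : ∀ G π v → vsum G π v ≡ wdeg G (label G π) v
vsum≡wdeg G π v = sumᴸ-allFin (E G) _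

wdeg-cong : ∀ G {w w′ : Fin (E G) → ℕ} v → (∀ e → w e ≡ w′ e) → wdeg G w v ≡ wdeg G w′ v
wdeg-cong G v w≗w′ = sum-cong-≗ λ e → cong (if incident G v e then_else 0) (w≗w′ e)

meets-injective : (f : Fin m → Fin n) → Injective _≡_ _≡_ f →
  ∀ a b v → meets (f a , f b) (f v) ≡ meets (a , b) v
meets-injective f f-inj a b v = cong₂ _∨_ (⌊≟⌋-injective f f-inj a v) (⌊≟⌋-injective f f-inj b v)

meets-≢ : ∀ {a b v : Fin n} → ¬ a ≡ v → ¬ b ≡ v → meets (a , b) v ≡ false
meets-≢ a≢v b≢v = cong₂ _∨_ (⌊≟⌋-≢ a≢v) (⌊≟⌋-≢ b≢v)

if-false : ∀ {b} {x : ℕ} → b ≡ false → (if b then x else 0) ≡ 0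
if-false refl = refl

if-true : ∀ {b} {x : ℕ} → b ≡ true → (if b then x else 0) ≡ x
if-true refl = refl

module _ (G H : Graph) where

  ends-⊕ˡ : ∀ e → ends (G ⊕ H) (e ↑ˡ E H) ≡ (proj₁ (ends G e) ↑ˡ V H , proj₂ (ends G e) ↑ˡ V H)
  ends-⊕ˡ e rewrite splitAt-↑ˡ (E G) e (E H) = refl

  ends-⊕ʳ : ∀ e → ends (G ⊕ H) (E G ↑ʳ e) ≡ (V G ↑ʳ proj₁ (ends H e) , V G ↑ʳ proj₂ (ends H e))
  ends-⊕ʳ e rewrite splitAt-↑ʳ (E G) (E H) e = refl

  wdeg-⊕ˡ : ∀ w x → wdeg (G ⊕ H) w (x ↑ˡ V H) ≡ wdeg G (w ∘ (_↑ˡ E H)) x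
  wdeg-⊕ˡ w x = trans (sum-↑ (E G) _)
    (trans (cong₂ _+_ (sum-cong-≗ λ e → cong (if_then _ else 0) (own e)) (sum-zero λ e → if-false (other e)))
           (+-identityʳ _))
    where
    own : ∀ e → incident (G ⊕ H) (x ↑ˡ V H) (e ↑ˡ E H) ≡ incident G x e
    own e rewrite ends-⊕ˡ e =
      meets-injective (_↑ˡ V H) (↑ˡ-injective (V H) _ _) (proj₁ (ends G e)) (proj₂ (ends G e)) x
    other : ∀ e → incident (G ⊕ H) (x ↑ˡ V H) (E G ↑ʳ e) ≡ false
    other e rewrite ends-⊕ʳ e = meets-≢ (↑ˡ≢↑ʳ x _ ∘ sym) (↑ˡ≢↑ʳ x _ ∘ sym)

  wdeg-⊕ʳ : ∀ w y → wdeg (G ⊕ H) w (V G ↑ʳ y) ≡ wdeg H (w ∘ (E G ↑ʳ_)) y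
  wdeg-⊕ʳ w y = trans (sum-↑ (E G) _)
    (trans (cong₂ _+_ (sum-zero λ e → if-false (other e)) (sum-cong-≗ λ e → cong (if_then _ else 0) (own e)))
           (+-identityˡ _))
    where
    own : ∀ e → incident (G ⊕ H) (V G ↑ʳ y) (E G ↑ʳ e) ≡ incident H y e
    own e rewrite ends-⊕ʳ e =
      meets-injective (V G ↑ʳ_) (↑ʳ-injective (V G) _ _) (proj₁ (ends H e)) (proj₂ (ends H e)) y
    other : ∀ e → incident (G ⊕ H) (V G ↑ʳ y) (e ↑ˡ E H) ≡ false
    other e rewrite ends-⊕ˡ e = meets-≢ (↑ˡ≢↑ʳ (proj₁ (ends G e)) y) (↑ˡ≢↑ʳ (proj₂ (ends G e)) y)

  innerEdge : Fin (E (G ⊕ H)) → Fin (E (G ∨ᴳ H))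
  innerEdge e = e ↑ˡ (V G * V H)

  crossEdge : Fin (V G) → Fin (V H) → Fin (E (G ∨ᴳ H))
  crossEdge x y = E (G ⊕ H) ↑ʳ combine x y

  ends-inner : ∀ e → ends (G ∨ᴳ H) (innerEdge e) ≡ ends (G ⊕ H) e
  ends-inner e rewrite splitAt-↑ˡ (E (G ⊕ H)) e (V G * V H) = refl

  ends-cross : ∀ x y → ends (G ∨ᴳ H) (crossEdge x y) ≡ (x ↑ˡ V H , V G ↑ʳ y)
  ends-cross x y rewrite splitAt-↑ʳ (E (G ⊕ H)) (V G * V H) (combine x y) =
    cong (λ p → proj₁ p ↑ˡ V H , V G ↑ʳ proj₂ p) (remQuot-combine x y)

  wdeg-∨ᴳ : ∀ w v → wdeg (G ∨ᴳ H) w v ≡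
    wdeg (G ⊕ H) (w ∘ innerEdge) v + ∑[ x < V G ] ∑[ y < V H ] (if meets (x ↑ˡ V H , V G ↑ʳ y) v then w (crossEdge x y) else 0)
  wdeg-∨ᴳ w v = trans (sum-↑ (E (G ⊕ H)) _)
    (cong₂ _+_ (sum-cong-≗ λ e → cong (if_then _ else 0) (cong (λ p → meets p v) (ends-inner e)))
               (trans (sum-combine (V G) _)
                      (sum-cong-≗ λ x → sum-cong-≗ λ y → cong (if_then _ else 0) (cong (λ p → meets p v) (ends-cross x y)))))

  wdeg-∨ᴳˡ : ∀ w x → wdeg (G ∨ᴳ H) w (x ↑ˡ V H) ≡ wdeg G (w ∘ innerEdge ∘ (_↑ˡ E H)) x + ∑[ y < V H ] w (crossEdge x y)
  wdeg-∨ᴳˡ w x = trans (wdeg-∨ᴳ w (x ↑ˡ V H)) (cong₂ _+_ (wdeg-⊕ˡ (w ∘ innerEdge) x)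
    (trans (sum-single x λ x′ x′≢x → sum-zero λ y →
              if-false (meets-≢ (x′≢x ∘ ↑ˡ-injective (V H) _ _) (↑ˡ≢↑ʳ x y ∘ sym)))
           (sum-cong-≗ λ y → if-true (cong (_∨ ⌊ V G ↑ʳ y ≟ᶠ x ↑ˡ V H ⌋) (⌊≟⌋-refl (x ↑ˡ V H))))))

  wdeg-∨ᴳʳ : ∀ w y → wdeg (G ∨ᴳ H) w (V G ↑ʳ y) ≡ wdeg H (w ∘ innerEdge ∘ (E G ↑ʳ_)) y + ∑[ x < V G ] w (crossEdge x y)
  wdeg-∨ᴳʳ w y = trans (wdeg-∨ᴳ w (V G ↑ʳ y)) (cong₂ _+_ (wdeg-⊕ʳ (w ∘ innerEdge) y)
    (sum-cong-≗ λ x → trans (sum-single y λ y′ y′≢y → if-false (meets-≢ (↑ˡ≢↑ʳ x y) (y′≢y ∘ ↑ʳ-injective (V G) _ _)))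
                            (if-true (trans (cong (⌊ x ↑ˡ V H ≟ᶠ V G ↑ʳ y ⌋ ∨_) (⌊≟⌋-refl (V G ↑ʳ y))) (∨-zeroʳ _)))))

module _ (H : Graph) where

  copyOfᵛ : ∀ m → Fin (V (copies m H)) → Fin m × Fin (V H)
  copyOfᵛ (suc m) = inBlocks (V H) (copyOfᵛ m)

  copyOfᵉ : ∀ m → Fin (E (copies m H)) → Fin m × Fin (E H)
  copyOfᵉ (suc m) = inBlocks (E H) (copyOfᵉ m)

  copyOfᵛ-injective : ∀ m → Injective _≡_ _≡_ (copyOfᵛ m)
  copyOfᵛ-injective (suc m) = inBlocks-injective (V H) (copyOfᵛ m) (copyOfᵛ-injective m)

  copyOfᵉ-injective : ∀ m → Injective _≡_ _≡_ (copyOfᵉ m)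
  copyOfᵉ-injective (suc m) = inBlocks-injective (E H) (copyOfᵉ m) (copyOfᵉ-injective m)

  wdeg-copies : ∀ m (w : Fin m → Fin (E H) → ℕ) v →
    wdeg (copies m H) (uncurry w ∘ copyOfᵉ m) v ≡ uncurry (λ k → wdeg H (w k)) (copyOfᵛ m v)
  wdeg-copies (suc m) w v with split (V H) (V (copies m H)) v
  ... | inˡ x = begin
    wdeg (copies (suc m) H) (uncurry w ∘ copyOfᵉ (suc m)) (x ↑ˡ _)
      ≡⟨ wdeg-⊕ˡ H (copies m H) _ x ⟩
    wdeg H (uncurry w ∘ copyOfᵉ (suc m) ∘ (_↑ˡ _)) x
      ≡⟨ wdeg-cong H x (cong (uncurry w) ∘ inBlocks-↑ˡ (E H) (copyOfᵉ m)) ⟩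
    wdeg H (w zero) x
      ≡⟨ cong (uncurry (λ k → wdeg H (w k))) (inBlocks-↑ˡ (V H) (copyOfᵛ m) x) ⟨
    uncurry (λ k → wdeg H (w k)) (copyOfᵛ (suc m) (x ↑ˡ _)) ∎
    where open ≡-Reasoning
  ... | inʳ y = begin
    wdeg (copies (suc m) H) (uncurry w ∘ copyOfᵉ (suc m)) (V H ↑ʳ y)
      ≡⟨ wdeg-⊕ʳ H (copies m H) _ y ⟩
    wdeg (copies m H) (uncurry w ∘ copyOfᵉ (suc m) ∘ (E H ↑ʳ_)) y
      ≡⟨ wdeg-cong (copies m H) y (cong (uncurry w) ∘ inBlocks-↑ʳ (E H) (copyOfᵉ m)) ⟩
    wdeg (copies m H) (uncurry (w ∘ suc) ∘ copyOfᵉ m) y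
      ≡⟨ wdeg-copies m (w ∘ suc) y ⟩
    uncurry (λ k → wdeg H (w (suc k))) (copyOfᵛ m y)
      ≡⟨ cong (uncurry (λ k → wdeg H (w k))) (inBlocks-↑ʳ (V H) (copyOfᵛ m) y) ⟨
    uncurry (λ k → wdeg H (w k)) (copyOfᵛ (suc m) (V H ↑ʳ y)) ∎
    where open ≡-Reasoning

  sum-copies : ∀ m (f : Fin m → Fin (V H) → ℕ) →
    ∑[ v < V (copies m H) ] uncurry f (copyOfᵛ m v) ≡ ∑[ k < m ] ∑[ x < V H ] f k x
  sum-copies zero    f = refl
  sum-copies (suc m) f = trans (sum-↑ (V H) _)
    (cong₂ _+_ (sum-cong-≗ λ x → cong (uncurry f) (inBlocks-↑ˡ (V H) (copyOfᵛ m) x))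
               (trans (sum-cong-≗ λ v → cong (uncurry f) (inBlocks-↑ʳ (V H) (copyOfᵛ m) v)) (sum-copies m (f ∘ suc))))

  copyOfᵛ-ends : ∀ m e → let (k , e′) = copyOfᵉ m e in
    copyOfᵛ m (proj₁ (ends (copies m H) e)) ≡ (k , proj₁ (ends H e′)) ×
    copyOfᵛ m (proj₂ (ends (copies m H) e)) ≡ (k , proj₂ (ends H e′))
  copyOfᵛ-ends (suc m) e with split (E H) (E (copies m H)) e
  ... | inˡ a rewrite ends-⊕ˡ H (copies m H) a | inBlocks-↑ˡ (E H) (copyOfᵉ m) a =
    inBlocks-↑ˡ (V H) (copyOfᵛ m) _ , inBlocks-↑ˡ (V H) (copyOfᵛ m) _
  ... | inʳ b rewrite ends-⊕ʳ H (copies m H) b | inBlocks-↑ʳ (E H) (copyOfᵉ m) b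
                    | inBlocks-↑ʳ (V H) (copyOfᵛ m) (proj₁ (ends (copies m H) b))
                    | inBlocks-↑ʳ (V H) (copyOfᵛ m) (proj₂ (ends (copies m H) b)) =
    Product.map (cong (map₁ suc)) (cong (map₁ suc)) (copyOfᵛ-ends m b)

copyOfᵛ-surjective : ∀ H m k x → ∃ λ v → copyOfᵛ H m v ≡ (k , x)
copyOfᵛ-surjective H (suc m) zero    x = x ↑ˡ _ , inBlocks-↑ˡ (V H) (copyOfᵛ H m) x
copyOfᵛ-surjective H (suc m) (suc k) x = let (v , eq) = copyOfᵛ-surjective H m k x in
  V H ↑ʳ v , trans (inBlocks-↑ʳ (V H) (copyOfᵛ H m) v) (cong (map₁ suc) eq)

E-copies : ∀ m H → E (copies m H) ≡ m * E H
E-copies zero    H = refl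
E-copies (suc m) H = cong (E H +_) (E-copies m H)

V-copies : ∀ m H → V (copies m H) ≡ m * V H
V-copies zero    H = refl
V-copies (suc m) H = cong (V H +_) (V-copies m H)

wdeg-P₂ : ∀ c x → wdeg P₂ (λ _ → c) x ≡ c
wdeg-P₂ c zero       = +-identityʳ c
wdeg-P₂ c (suc zero) = +-identityʳ c

-- Proper colourings and triangles

Proper : (G : Graph) {C : Set} → (Fin (V G) → C) → Set
Proper G c = ∀ e → ¬ c (proj₁ (ends G e)) ≡ c (proj₂ (ends G e))

Proper-copies : ∀ H m {C : Set} {c : Fin (V H) → C} → Proper H c → Proper (copies m H) (c ∘ proj₂ ∘ copyOfᵛ H m)
Proper-copies H m {c = c} proper e eq with copyOfᵛ-ends H m e
... | end₁ , end₂ =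
  proper (proj₂ (copyOfᵉ H m e)) (trans (cong (c ∘ proj₂) (sym end₁)) (trans eq (cong (c ∘ proj₂) end₂)))

Proper-∨ᴳ : ∀ G H {C : Set} {c₁ : Fin (V G) → C} {c₂ : Fin (V H) → C} →
  Proper G c₁ → Proper H c₂ → (∀ x y → ¬ c₁ x ≡ c₂ y) → Proper (G ∨ᴳ H) ([ c₁ , c₂ ]′ ∘ splitAt (V G))
Proper-∨ᴳ G H proper₁ proper₂ apart e with split (E (G ⊕ H)) (V G * V H) e
... | inʳ p with combine-surjective {V G} {V H} p
...   | x , y , refl rewrite ends-cross G H x y | splitAt-↑ˡ (V G) x (V H) | splitAt-↑ʳ (V G) (V H) y = apart x y
Proper-∨ᴳ G H proper₁ proper₂ apart _ | inˡ e with split (E G) (E H) e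
... | inˡ a rewrite ends-inner G H (a ↑ˡ E H) | ends-⊕ˡ G H a
                  | splitAt-↑ˡ (V G) (proj₁ (ends G a)) (V H) | splitAt-↑ˡ (V G) (proj₂ (ends G a)) (V H) = proper₁ a
... | inʳ b rewrite ends-inner G H (E G ↑ʳ b) | ends-⊕ʳ G H b
                  | splitAt-↑ʳ (V G) (V H) (proj₁ (ends H b)) | splitAt-↑ʳ (V G) (V H) (proj₂ (ends H b)) = proper₂ b

module _ (G : Graph) (π : Permutation′ (E G)) {k} (colour : Fin (V G) → Fin k) (value : Fin k → ℕ)
         (value-injective : Injective _≡_ _≡_ value) (vsum≡value : ∀ v → vsum G π v ≡ value (colour v)) where

  LocalAntimagic-colouring : Proper G colour → LocalAntimagic G π
  LocalAntimagic-colouring proper e eq =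
    proper e (value-injective (trans (sym (vsum≡value _)) (trans eq (vsum≡value _))))

  numValues-colouring : (∀ i → ∃ λ v → colour v ≡ i) → numValues G π ≡ k
  numValues-colouring onto = ≤-antisym
    (length-deduplicate-≤ _≟ℕ_ {xs = vsums} value λ x∈ →
      let (v , _ , x≡) = ∈-map⁻ (vsum G π) x∈ in colour v , sym (trans x≡ (vsum≡value v)))
    (≤-length-deduplicate _≟ℕ_ {xs = vsums} value value-injective λ i →
      let (v , colour≡) = onto i in subst (_∈ vsums) (trans (vsum≡value v) (cong value colour≡)) (∈-map⁺ (vsum G π) (∈-allFin v)))
    where
    vsums = map (vsum G π) (allFin (V G))

Adjacent : (G : Graph) → Fin (V G) → Fin (V G) → Set
Adjacent G a b = ∃ λ e → ends G e ≡ (a , b)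

record Triangle (G : Graph) : Set where
  field
    {a b c} : Fin (V G)
    ab : Adjacent G a b
    bc : Adjacent G b c
    ac : Adjacent G a c

module _ (G H : Graph) where

  Adjacent-⊕ˡ : ∀ {a b} → Adjacent G a b → Adjacent (G ⊕ H) (a ↑ˡ V H) (b ↑ˡ V H)
  Adjacent-⊕ˡ (e , refl) = e ↑ˡ E H , ends-⊕ˡ G H e

  Adjacent-inner : ∀ {a b} → Adjacent (G ⊕ H) a b → Adjacent (G ∨ᴳ H) a b
  Adjacent-inner (e , refl) = innerEdge G H e , ends-inner G H e

  Adjacent-cross : ∀ x y → Adjacent (G ∨ᴳ H) (x ↑ˡ V H) (V G ↑ʳ y)
  Adjacent-cross x y = crossEdge G H x y , ends-cross G H x y

  Triangle-⊕ˡ : Triangle G → Triangle (G ⊕ H)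
  Triangle-⊕ˡ t = record { ab = Adjacent-⊕ˡ ab ; bc = Adjacent-⊕ˡ bc ; ac = Adjacent-⊕ˡ ac }
    where open Triangle t

  Triangle-∨ᴳ : ∀ {a b} → Adjacent G a b → Fin (V H) → Triangle (G ∨ᴳ H)
  Triangle-∨ᴳ ab y = record { ab = Adjacent-inner (Adjacent-⊕ˡ ab) ; bc = Adjacent-cross _ y ; ac = Adjacent-cross _ y }

Triangle-copies : ∀ {m} H → 1 ≤ m → Triangle H → Triangle (copies m H)
Triangle-copies {suc m} H _ = Triangle-⊕ˡ H (copies m H)

Adjacent-P₂ : Adjacent P₂ zero (suc zero)
Adjacent-P₂ = zero , refl

LocalAntimagic-adjacent : ∀ G π {a b} → LocalAntimagic G π → Adjacent G a b → ¬ vsum G π a ≡ vsum G π b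
LocalAntimagic-adjacent G π antimagic (e , refl) = antimagic e

3≤numValues : ∀ G π → Triangle G → LocalAntimagic G π → 3 ≤ numValues G π
3≤numValues G π t antimagic =
  ≤-length-deduplicate _≟ℕ_ (vsum G π ∘ corner) injective (λ i → ∈-map⁺ (vsum G π) (∈-allFin (corner i)))
  where
  open Triangle t
  corner : Fin 3 → Fin (V G)
  corner zero             = a
  corner (suc zero)       = b
  corner (suc (suc zero)) = c
  apart : ∀ {x y} → Adjacent G x y → ¬ vsum G π x ≡ vsum G π y
  apart = LocalAntimagic-adjacent G π antimagic
  injective : Injective _≡_ _≡_ (vsum G π ∘ corner)
  injective {zero}           {zero}           _  = refl
  injective {zero}           {suc zero}       eq = contradiction eq (apart ab)
  injective {zero}           {suc (suc zero)} eq = contradiction eq (apart ac)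
  injective {suc zero}       {zero}           eq = contradiction (sym eq) (apart ab)
  injective {suc zero}       {suc zero}       _  = refl
  injective {suc zero}       {suc (suc zero)} eq = contradiction eq (apart bc)
  injective {suc (suc zero)} {zero}           eq = contradiction (sym eq) (apart ac)
  injective {suc (suc zero)} {suc zero}       eq = contradiction (sym eq) (apart bc)
  injective {suc (suc zero)} {suc (suc zero)} _  = refl

-- A 3 × (2h + 1) magic rectangle

data Row : Set where
  r₀ r₁ r₂ : Row

magic : ℕ → Row → ℕ → ℕ
magic h r₀ i = i
magic h r₁ i = if i ≤ᵇ h then i + h else i ∸ suc h
magic h r₂ i = if i ≤ᵇ h then 2 * (h ∸ i) else suc (2 * ((h + h) ∸ i))

data MagicView (h i : ℕ) : Set where
  low  : ∀ e → i + e ≡ h →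
         magic h r₁ i ≡ i + h → magic h r₂ i ≡ 2 * e → MagicView h i
  high : ∀ d e → suc d + e ≡ h → suc h + d ≡ i →
         magic h r₁ i ≡ d → magic h r₂ i ≡ suc (2 * e) → MagicView h i

magic-view : ∀ h i → i ≤ h + h → MagicView h i
magic-view h i i≤2h with i ≤ᵇ h in i≤ᵇh
... | true  = low (h ∸ i) (m+[n∸m]≡n (≤ᵇ⇒≤ i h (subst T (sym i≤ᵇh) _))) row₁ row₂
  where
  row₁ = cong (if_then i + h else i ∸ suc h) i≤ᵇh
  row₂ = cong (if_then 2 * (h ∸ i) else suc (2 * (h + h ∸ i))) i≤ᵇh
... | false = high (i ∸ suc h) (h + h ∸ i) d+e≡h h+d≡i row₁ row₂
  where
  row₁ = cong (if_then i + h else i ∸ suc h) i≤ᵇh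
  row₂ = cong (if_then 2 * (h ∸ i) else suc (2 * (h + h ∸ i))) i≤ᵇh
  h+d≡i : suc h + (i ∸ suc h) ≡ i
  h+d≡i = m+[n∸m]≡n (≰⇒> λ i≤h → subst T i≤ᵇh (≤⇒≤ᵇ i≤h))
  d+e≡h : suc (i ∸ suc h) + (h + h ∸ i) ≡ h
  d+e≡h = +-cancelˡ-≡ h _ _ (begin
    h + (suc (i ∸ suc h) + (h + h ∸ i))   ≡⟨ solve (h ∷ []) ⟩
    suc h + (i ∸ suc h) + (h + h ∸ i)     ≡⟨ cong (_+ (h + h ∸ i)) h+d≡i ⟩
    i + (h + h ∸ i)                       ≡⟨ m+[n∸m]≡n i≤2h ⟩
    h + h                                 ∎)
    where open ≡-Reasoning

magic-sum : ∀ h i → i ≤ h + h → magic h r₀ i + magic h r₁ i + magic h r₂ i ≡ h + h + h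
magic-sum h i i≤2h with magic-view h i i≤2h
... | low e refl row₁ row₂ rewrite row₁ | row₂ = solve (i ∷ e ∷ [])
... | high d e refl refl row₁ row₂ rewrite row₁ | row₂ = solve (d ∷ e ∷ [])

≤-by : ∀ m n {o} → m + n ≡ o → m ≤ o
≤-by m n m+n≡o = m+n≤o⇒m≤o m (≤-reflexive m+n≡o)

magic-≤ : ∀ h ρ i → i ≤ h + h → magic h ρ i ≤ h + h
magic-≤ h r₀ i i≤2h = i≤2h
magic-≤ h r₁ i i≤2h with magic-view h i i≤2h
... | low e refl row₁ _ rewrite row₁ = ≤-by (i + (i + e)) e (solve (i ∷ e ∷ []))
... | high d e refl refl row₁ _ rewrite row₁ = ≤-by d (suc (e + suc (d + e))) (solve (d ∷ e ∷ []))
magic-≤ h r₂ i i≤2h with magic-view h i i≤2h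
... | low e refl _ row₂ rewrite row₂ = ≤-by (2 * e) (i + i) (solve (i ∷ e ∷ []))
... | high d e refl refl _ row₂ rewrite row₂ = ≤-by (suc (2 * e)) (suc (2 * d)) (solve (d ∷ e ∷ []))

magic-injective : ∀ h ρ {i j} → i ≤ h + h → j ≤ h + h → magic h ρ i ≡ magic h ρ j → i ≡ j
magic-injective h r₀ _ _ eq = eq
magic-injective h r₁ {i} {j} i≤2h j≤2h eq with magic-view h i i≤2h | magic-view h j j≤2h
... | low _ _ i₁ _ | low _ _ j₁ _ = +-cancelʳ-≡ h i j (trans (sym i₁) (trans eq j₁))
... | high _ _ _ i≡ i₁ _ | high _ _ _ j≡ j₁ _ = trans (sym i≡) (trans (cong (suc h +_) (trans (sym i₁) (trans eq j₁))) j≡)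
... | low _ _ i₁ _ | high d e d+e≡h _ j₁ _ =
  contradiction (trans (sym i₁) (trans eq j₁)) (>⇒≢ (≤-trans (≤-by (suc d) e d+e≡h) (m≤n+m h i)))
... | high d e d+e≡h _ i₁ _ | low _ _ j₁ _ =
  contradiction (trans (sym j₁) (trans (sym eq) i₁)) (>⇒≢ (≤-trans (≤-by (suc d) e d+e≡h) (m≤n+m h j)))
magic-injective h r₂ {i} {j} i≤2h j≤2h eq with magic-view h i i≤2h | magic-view h j j≤2h
... | low e i+e≡h _ i₂ | low e′ j+e′≡h _ j₂ =
  +-cancelʳ-≡ e i j (trans i+e≡h (trans (sym j+e′≡h) (cong (j +_) (sym e≡e′))))
  where
  e≡e′ : e ≡ e′
  e≡e′ = *-cancelˡ-≡ e e′ 2 (trans (sym i₂) (trans eq j₂))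
... | high d e d+e≡h i≡ _ i₂ | high d′ e′ d′+e′≡h j≡ _ j₂ = trans (sym i≡) (trans (cong (suc h +_) d≡d′) j≡)
  where
  e≡e′ : e ≡ e′
  e≡e′ = *-cancelˡ-≡ e e′ 2 (ℕ.suc-injective (trans (sym i₂) (trans eq j₂)))
  d≡d′ : d ≡ d′
  d≡d′ = +-cancelʳ-≡ e d d′ (ℕ.suc-injective (trans d+e≡h (trans (sym d′+e′≡h) (cong (suc d′ +_) (sym e≡e′)))))
... | low e _ _ i₂ | high _ e′ _ _ _ j₂ = contradiction (trans (sym i₂) (trans eq j₂)) (even≢odd e e′)
... | high _ e _ _ _ i₂ | low e′ _ _ j₂ = contradiction (trans (sym j₂) (trans (sym eq) i₂)) (even≢odd e′ e)

shift : Row → Row → Row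
shift r₀ ρ  = ρ
shift r₁ r₀ = r₁
shift r₁ r₁ = r₂
shift r₁ r₂ = r₀
shift r₂ r₀ = r₂
shift r₂ r₁ = r₀
shift r₂ r₂ = r₁

magic-sum-shift : ∀ h c i → i ≤ h + h →
  magic h (shift c r₀) i + magic h (shift c r₁) i + magic h (shift c r₂) i ≡ h + h + h
magic-sum-shift h r₀ i i≤2h = magic-sum h i i≤2h
magic-sum-shift h r₁ i i≤2h = trans (rotate (magic h r₀ i) _ _) (magic-sum h i i≤2h)
  where
  rotate : ∀ a b c → b + c + a ≡ a + b + c
  rotate = solve-∀
magic-sum-shift h r₂ i i≤2h = trans (rotate (magic h r₀ i) _ _) (magic-sum h i i≤2h)
  where
  rotate : ∀ a b c → c + a + b ≡ a + b + c
  rotate = solve-∀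

reflect : ℕ → ℕ → ℕ
reflect h x = h + h ∸ x

reflectIf : Bool → ℕ → ℕ → ℕ
reflectIf false h x = x
reflectIf true  h x = reflect h x

x+reflect : ∀ h {x} → x ≤ h + h → x + reflect h x ≡ h + h
x+reflect h x≤2h = m+[n∸m]≡n x≤2h

reflectIf-≤ : ∀ b h {x} → x ≤ h + h → reflectIf b h x ≤ h + h
reflectIf-≤ false h x≤2h = x≤2h
reflectIf-≤ true  h {x} _ = m∸n≤m (h + h) x

reflectIf-injective : ∀ b h {x y} → x ≤ h + h → y ≤ h + h → reflectIf b h x ≡ reflectIf b h y → x ≡ y
reflectIf-injective false h _ _ eq = eq
reflectIf-injective true  h x≤2h y≤2h eq = ∸-cancelˡ-≡ x≤2h y≤2h eq

reflectIf-sum : ∀ b h {x y z} → x ≤ h + h → y ≤ h + h → z ≤ h + h → x + y + z ≡ h + h + h →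
  reflectIf b h x + reflectIf b h y + reflectIf b h z ≡ h + h + h
reflectIf-sum false h _ _ _ sum≡ = sum≡
reflectIf-sum true  h {x} {y} {z} x≤2h y≤2h z≤2h sum≡ = +-cancelʳ-≡ (x + y + z) _ _ (begin
  reflect h x + reflect h y + reflect h z + (x + y + z)
    ≡⟨ regroup (reflect h x) (reflect h y) (reflect h z) x y z ⟩
  (x + reflect h x) + (y + reflect h y) + (z + reflect h z)
    ≡⟨ cong₂ _+_ (cong₂ _+_ (x+reflect h x≤2h) (x+reflect h y≤2h)) (x+reflect h z≤2h) ⟩
  (h + h) + (h + h) + (h + h)
    ≡⟨ solve (h ∷ []) ⟩
  h + h + h + (h + h + h)
    ≡⟨ cong (h + h + h +_) (sym sum≡) ⟩
  h + h + h + (x + y + z) ∎)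
  where
  open ≡-Reasoning
  regroup : ∀ a b c x y z → a + b + c + (x + y + z) ≡ (x + a) + (y + b) + (z + c)
  regroup = solve-∀

-- The labelling

-- In a copy of (2s+1)P₂ ∨ O₂ the j-th P₂ is x_j y_j and O₂ = {u, v}.
data EdgeType : Set where
  path xu xv yu yv : EdgeType

-- The digit sums are 2 + 0 + 1 at x_j, 2 + 4 + 3 at y_j, and 0 + 4 = 1 + 3 at u and at v.
digit : EdgeType → Fin 5
digit xu   = zero
digit xv   = suc zero
digit path = suc (suc zero)
digit yv   = suc (suc (suc zero))
digit yu   = suc (suc (suc (suc zero)))

digit-injective : ∀ {a b} → digit a ≡ digit b → a ≡ b
digit-injective {a} {b} eq = trans (sym (undigit-digit a)) (trans (cong undigit eq) (undigit-digit b))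
  where
  undigit : Fin 5 → EdgeType
  undigit zero                         = xu
  undigit (suc zero)                   = xv
  undigit (suc (suc zero))             = path
  undigit (suc (suc (suc zero)))       = yv
  undigit (suc (suc (suc (suc zero)))) = yu
  undigit-digit : ∀ a → undigit (digit a) ≡ a
  undigit-digit path = refl
  undigit-digit xu   = refl
  undigit-digit xv   = refl
  undigit-digit yu   = refl
  undigit-digit yv   = refl

-- xv shares its row with yu, and yv with xu: the labels at v are then those at u with
-- x and y exchanged, which makes f⁺(u) = f⁺(v).
row : EdgeType → Row
row path = r₀
row xu   = r₁
row xv   = r₂
row yu   = r₂
row yv   = r₁

phase : ℕ → Row
phase 0 = r₀
phase 1 = r₁
phase 2 = r₂
phase _ = r₀

-- flipped j holds exactly for the even j ≥ 4.
flipped : ℕ → Bool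
flipped (suc (suc (suc (suc (suc j))))) = flipped (suc (suc (suc j)))
flipped 4 = true
flipped _ = false

<2h+1⇒≤h+h : ∀ h {x} → x < 2 * h + 1 → x ≤ h + h
<2h+1⇒≤h+h h x< = ≤-pred (≤-trans x< (≤-reflexive (solve (h ∷ []))))

≤h+h⇒<2h+1 : ∀ h {x} → x ≤ h + h → x < 2 * h + 1
≤h+h⇒<2h+1 h x≤ = ≤-trans (s≤s x≤) (≤-reflexive (solve (h ∷ [])))

module Construction (r t : ℕ) where

  s M N : ℕ
  s = suc t
  M = 2 * r + 1
  N = 2 * s + 1

  σ : EdgeType → ℕ → ℕ → ℕ
  σ a j k = reflectIf (flipped j) r (magic r (shift (phase j) (row a)) k)

  τ : EdgeType → ℕ → ℕ
  τ a j = magic s (row a) j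

  toℕ≤r+r : ∀ (k : Fin M) → toℕ k ≤ r + r
  toℕ≤r+r k = <2h+1⇒≤h+h r (toℕ<n k)

  toℕ≤s+s : ∀ (j : Fin N) → toℕ j ≤ s + s
  toℕ≤s+s j = <2h+1⇒≤h+h s (toℕ<n j)

  σ-≤ : ∀ a j {k} → k ≤ r + r → σ a j k ≤ r + r
  σ-≤ a j {k} k≤2r = reflectIf-≤ (flipped j) r (magic-≤ r (shift (phase j) (row a)) k k≤2r)

  τ-≤ : ∀ a {j} → j ≤ s + s → τ a j ≤ s + s
  τ-≤ a j≤2s = magic-≤ s (row a) _ j≤2s

  σᶠ : EdgeType → Fin N → Fin M → Fin M
  σᶠ a j k = fromℕ< (≤h+h⇒<2h+1 r (σ-≤ a (toℕ j) (toℕ≤r+r k)))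

  τᶠ : EdgeType → Fin N → Fin N
  τᶠ a j = fromℕ< (≤h+h⇒<2h+1 s (τ-≤ a (toℕ≤s+s j)))

  code : Fin M → EdgeType → Fin N → Fin (5 * M * N)
  code k a j = combine (combine (digit a) (σᶠ a j k)) (τᶠ a j)

  toℕ-code : ∀ k a j → toℕ (code k a j) ≡ N * (M * toℕ (digit a) + σ a (toℕ j) (toℕ k)) + τ a (toℕ j)
  toℕ-code k a j = trans (toℕ-combine (combine (digit a) (σᶠ a j k)) (τᶠ a j))
    (cong₂ (λ x y → N * x + y) (trans (toℕ-combine (digit a) (σᶠ a j k)) (cong (M * toℕ (digit a) +_) (toℕ-fromℕ< _)))
                               (toℕ-fromℕ< _))

  τᶠ-injective : ∀ a {j j′} → τᶠ a j ≡ τᶠ a j′ → j ≡ j′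
  τᶠ-injective a {j} {j′} eq =
    toℕ-injective (magic-injective s (row a) (toℕ≤s+s j) (toℕ≤s+s j′) (fromℕ<-injective _ _ _ _ eq))

  σᶠ-injective : ∀ a j {k k′} → σᶠ a j k ≡ σᶠ a j k′ → k ≡ k′
  σᶠ-injective a j {k} {k′} eq = toℕ-injective (magic-injective r ρ (toℕ≤r+r k) (toℕ≤r+r k′)
    (reflectIf-injective (flipped (toℕ j)) r (magic-≤ r ρ _ (toℕ≤r+r k)) (magic-≤ r ρ _ (toℕ≤r+r k′))
                         (fromℕ<-injective _ _ _ _ eq)))
    where
    ρ = shift (phase (toℕ j)) (row a)

  code-injective : ∀ {k a j k′ a′ j′} → code k a j ≡ code k′ a′ j′ → k ≡ k′ × a ≡ a′ × j ≡ j′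
  code-injective {k} {a} {j} {k′} {a′} {j′} eq
    with combine-injective (combine (digit a) (σᶠ a j k)) (τᶠ a j) (combine (digit a′) (σᶠ a′ j′ k′)) (τᶠ a′ j′) eq
  ... | outer≡ , τᶠ≡ with combine-injective (digit a) (σᶠ a j k) (digit a′) (σᶠ a′ j′ k′) outer≡
  ... | digit≡ , σᶠ≡ with refl ← digit-injective digit≡ with refl ← τᶠ-injective a τᶠ≡ =
    σᶠ-injective a j σᶠ≡ , refl , refl

  Paths Join Whole : Graph
  Paths = copies N P₂
  Join  = Paths ∨ᴳ O 2
  Whole = copies M Join

  crossType : Fin 2 → Fin 2 → EdgeType
  crossType zero       zero       = xu
  crossType zero       (suc zero) = xv
  crossType (suc zero) zero       = yu
  crossType (suc zero) (suc zero) = yv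

  crossType-injective : ∀ {i b i′ b′} → crossType i b ≡ crossType i′ b′ → i ≡ i′ × b ≡ b′
  crossType-injective {i} {b} {i′} {b′} eq =
    ,-injective (trans (sym (uncross-cross i b)) (trans (cong uncross eq) (uncross-cross i′ b′)))
    where
    uncross : EdgeType → Fin 2 × Fin 2
    uncross xv = zero , suc zero
    uncross yu = suc zero , zero
    uncross yv = suc zero , suc zero
    uncross _  = zero , zero
    uncross-cross : ∀ i b → uncross (crossType i b) ≡ (i , b)
    uncross-cross zero       zero       = refl
    uncross-cross zero       (suc zero) = refl
    uncross-cross (suc zero) zero       = refl
    uncross-cross (suc zero) (suc zero) = refl

  path≢crossType : ∀ i b → ¬ path ≡ crossType i b
  path≢crossType zero       zero       ()
  path≢crossType zero       (suc zero) ()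
  path≢crossType (suc zero) zero       ()
  path≢crossType (suc zero) (suc zero) ()

  pathClass : Fin (E (Paths ⊕ O 2)) → EdgeType × Fin N
  pathClass e = path , proj₁ (copyOfᵉ P₂ N ([ id , (λ ()) ]′ (splitAt (E Paths) e)))

  crossClass : Fin (V Paths) × Fin 2 → EdgeType × Fin N
  crossClass (y , b) = crossType (proj₂ (copyOfᵛ P₂ N y)) b , proj₁ (copyOfᵛ P₂ N y)

  edgeClass : Fin (E Join) → EdgeType × Fin N
  edgeClass = [ pathClass , crossClass ∘ remQuot 2 ]′ ∘ splitAt (E (Paths ⊕ O 2))

  data JoinEdge : Fin (E Join) → Set where
    along  : ∀ a → JoinEdge (innerEdge Paths (O 2) (a ↑ˡ 0))
    across : ∀ y b → JoinEdge (crossEdge Paths (O 2) y b)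

  joinEdge : ∀ e → JoinEdge e
  joinEdge e with split (E (Paths ⊕ O 2)) (V Paths * 2) e
  ... | inˡ e₀ with split (E Paths) 0 e₀
  ...   | inˡ a = along a
  joinEdge _ | inʳ p with combine-surjective {V Paths} {2} p
  ...   | y , b , refl = across y b

  edgeClass-along : ∀ a → edgeClass (innerEdge Paths (O 2) (a ↑ˡ 0)) ≡ (path , proj₁ (copyOfᵉ P₂ N a))
  edgeClass-along a rewrite splitAt-↑ˡ (E (Paths ⊕ O 2)) (a ↑ˡ 0) (V Paths * 2) | splitAt-↑ˡ (E Paths) a 0 = refl

  edgeClass-across : ∀ y b → edgeClass (crossEdge Paths (O 2) y b) ≡ crossClass (y , b)
  edgeClass-across y b rewrite splitAt-↑ʳ (E (Paths ⊕ O 2)) (V Paths * 2) (combine y b) =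
    cong crossClass (remQuot-combine y b)

  edgeClass-injective : Injective _≡_ _≡_ edgeClass
  edgeClass-injective {e} {e′} = go (joinEdge e) (joinEdge e′)
    where
    fin1 : ∀ (i j : Fin 1) → i ≡ j
    fin1 zero zero = refl
    go : ∀ {e e′} → JoinEdge e → JoinEdge e′ → edgeClass e ≡ edgeClass e′ → e ≡ e′
    go (along a) (along a′) eq = cong (innerEdge Paths (O 2) ∘ (_↑ˡ 0))
      (copyOfᵉ-injective P₂ N (×-≡,≡→≡ (cong proj₂ (trans (sym (edgeClass-along a)) (trans eq (edgeClass-along a′))) , fin1 _ _)))
    go (along a) (across y b) eq =
      contradiction (cong proj₁ (trans (sym (edgeClass-along a)) (trans eq (edgeClass-across y b)))) (path≢crossType _ b)
    go (across y b) (along a) eq =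
      contradiction (cong proj₁ (trans (sym (edgeClass-along a)) (trans (sym eq) (edgeClass-across y b)))) (path≢crossType _ b)
    go (across y b) (across y′ b′) eq = same-cross (trans (sym (edgeClass-across y b)) (trans eq (edgeClass-across y′ b′)))
      where
      same-cross : crossClass (y , b) ≡ crossClass (y′ , b′) → crossEdge Paths (O 2) y b ≡ crossEdge Paths (O 2) y′ b′
      same-cross class≡ with crossType-injective {proj₂ (copyOfᵛ P₂ N y)} {b} {proj₂ (copyOfᵛ P₂ N y′)} {b′} (cong proj₁ class≡)
      ... | side≡ , refl =
        cong (λ y → crossEdge Paths (O 2) y b) (copyOfᵛ-injective P₂ N {y} {y′} (×-≡,≡→≡ (cong proj₂ class≡ , side≡)))

  weight : Fin M → Fin (E Join) → ℕ
  weight k e = suc (toℕ (uncurry (code k) (edgeClass e)))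

  colour : Fin (V Join) → Fin 3
  colour = [ inject₁ ∘ proj₂ ∘ copyOfᵛ P₂ N , (λ _ → fromℕ 2) ]′ ∘ splitAt (V Paths)

  colour-↑ˡ : ∀ y → colour (y ↑ˡ 2) ≡ inject₁ (proj₂ (copyOfᵛ P₂ N y))
  colour-↑ˡ y rewrite splitAt-↑ˡ (V Paths) y 2 = refl

  colour-↑ʳ : ∀ b → colour (V Paths ↑ʳ b) ≡ fromℕ 2
  colour-↑ʳ b rewrite splitAt-↑ʳ (V Paths) 2 b = refl

  hubσ hubτ : ℕ
  hubσ = (r + r + r) + (r + r + r) + t * ((r + r) + (r + r))
  hubτ = ∑[ j < N ] (2 + (τ xu (toℕ j) + τ yu (toℕ j)))

  value : Fin 3 → ℕ
  value zero             = 3 + N * (M * 3 + (r + r + r)) + (s + s + s)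
  value (suc zero)       = 3 + N * (M * 9 + (r + r + r)) + (s + s + s)
  value (suc (suc zero)) = N * (N * (M * 4) + hubσ) + hubτ

  three-codes-sum : ∀ k j a b c →
    suc (toℕ (code k a j)) + (suc (toℕ (code k b j)) + (suc (toℕ (code k c j)) + 0))
      ≡ 3 + N * (M * (toℕ (digit a) + toℕ (digit b) + toℕ (digit c))
                 + (σ a (toℕ j) (toℕ k) + σ b (toℕ j) (toℕ k) + σ c (toℕ j) (toℕ k)))
          + (τ a (toℕ j) + τ b (toℕ j) + τ c (toℕ j))
  three-codes-sum k j a b c rewrite toℕ-code k a j | toℕ-code k b j | toℕ-code k c j = collect N M _ _ _ _ _ _ _ _ _
    where
    collect : ∀ N M da db dc σa σb σc τa τb τc →
      suc (N * (M * da + σa) + τa) + (suc (N * (M * db + σb) + τb) + (suc (N * (M * dc + σc) + τc) + 0))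
        ≡ 3 + N * (M * (da + db + dc) + (σa + σb + σc)) + (τa + τb + τc)
    collect = solve-∀

  magic-sum-side : ∀ side h c i → i ≤ h + h →
    magic h (shift c r₀) i + magic h (shift c (row (crossType side zero))) i
      + magic h (shift c (row (crossType side (suc zero)))) i ≡ h + h + h
  magic-sum-side zero       h c i i≤2h = magic-sum-shift h c i i≤2h
  magic-sum-side (suc zero) h c i i≤2h = trans (swap (magic h (shift c r₀) i) _ _) (magic-sum-shift h c i i≤2h)
    where
    swap : ∀ x y z → x + z + y ≡ x + y + z
    swap = solve-∀

  σ-sum-side : ∀ side j {k} → k ≤ r + r →
    σ path j k + σ (crossType side zero) j k + σ (crossType side (suc zero)) j k ≡ r + r + r
  σ-sum-side side j {k} k≤2r = reflectIf-sum (flipped j) r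
    (bound path) (bound (crossType side zero)) (bound (crossType side (suc zero))) (magic-sum-side side r (phase j) k k≤2r)
    where
    bound : ∀ a → magic r (shift (phase j) (row a)) k ≤ r + r
    bound a = magic-≤ r (shift (phase j) (row a)) k k≤2r

  path-vertex-value : ∀ k j side →
    suc (toℕ (code k path j)) + ∑[ b < 2 ] suc (toℕ (code k (crossType side b) j)) ≡ value (inject₁ side)
  path-vertex-value k j side = begin
    suc (toℕ (code k path j)) + ∑[ b < 2 ] suc (toℕ (code k (crossType side b) j))
      ≡⟨ three-codes-sum k j path (crossType side zero) (crossType side (suc zero)) ⟩
    3 + N * (M * digits side + (σ path j′ k′ + σ (crossType side zero) j′ k′ + σ (crossType side (suc zero)) j′ k′))
      + (τ path j′ + τ (crossType side zero) j′ + τ (crossType side (suc zero)) j′)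
      ≡⟨ cong₂ (λ x y → 3 + N * (M * digits side + x) + y)
               (σ-sum-side side j′ (toℕ≤r+r k)) (magic-sum-side side s r₀ j′ (toℕ≤s+s j)) ⟩
    3 + N * (M * digits side + (r + r + r)) + (s + s + s)
      ≡⟨ by-side side ⟩
    value (inject₁ side) ∎
    where
    open ≡-Reasoning
    j′ = toℕ j
    k′ = toℕ k
    digits : Fin 2 → ℕ
    digits side = toℕ (digit path) + toℕ (digit (crossType side zero)) + toℕ (digit (crossType side (suc zero)))
    by-side : ∀ side → 3 + N * (M * digits side + (r + r + r)) + (s + s + s) ≡ value (inject₁ side)
    by-side zero       = refl
    by-side (suc zero) = refl

  σ-hub-sum : ∀ {k} → k ≤ r + r → ∑[ j < N ] (σ xu (toℕ j) k + σ yu (toℕ j) k) ≡ hubσ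
  σ-hub-sum {k} k≤2r = begin
    ∑[ j < N ] g (toℕ j)
      ≡⟨ cong (λ n → ∑[ j < n ] g (toℕ j)) (N≡3+2t t) ⟩
    g 0 + (g 1 + (g 2 + ∑[ j < t + t ] g (3 + toℕ j)))
      ≡⟨ cong (λ x → g 0 + (g 1 + (g 2 + x))) (sum-periodic t (g ∘ (3 +_)) λ _ → refl) ⟩
    g 0 + (g 1 + (g 2 + t * (g 3 + g 4)))
      ≡⟨ regroup (P r₀) (P r₁) (P r₂) _ ⟩
    (P r₀ + P r₁ + P r₂) + (P r₀ + P r₁ + P r₂) + t * (g 3 + g 4)
      ≡⟨ cong₂ (λ x y → x + x + t * y) (magic-sum r k k≤2r) pairs ⟩
    hubσ ∎
    where
    open ≡-Reasoning
    g : ℕ → ℕ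
    g j = σ xu j k + σ yu j k
    P : Row → ℕ
    P ρ = magic r ρ k
    N≡3+2t : ∀ t → 2 * suc t + 1 ≡ 3 + (t + t)
    N≡3+2t = solve-∀
    regroup : ∀ a b c x → b + c + (c + a + (a + b + x)) ≡ a + b + c + (a + b + c) + x
    regroup = solve-∀
    interleave : ∀ a b a′ b′ → a + b + (a′ + b′) ≡ a + a′ + (b + b′)
    interleave = solve-∀
    pairs : g 3 + g 4 ≡ (r + r) + (r + r)
    pairs = trans (interleave (P r₁) (P r₂) (reflect r (P r₁)) (reflect r (P r₂)))
                  (cong₂ _+_ (x+reflect r (magic-≤ r r₁ k k≤2r)) (x+reflect r (magic-≤ r r₂ k k≤2r)))

  hub-value : ∀ k b → ∑[ j < N ] ∑[ side < 2 ] suc (toℕ (code k (crossType side b) j)) ≡ value (fromℕ 2)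
  hub-value k zero = begin
    ∑[ j < N ] (suc (toℕ (code k xu j)) + (suc (toℕ (code k yu j)) + 0))
      ≡⟨ sum-cong-≗ {y = λ j → N * (M * 4 + S (toℕ j)) + (2 + (τ xu (toℕ j) + τ yu (toℕ j)))} (λ j →
           trans (cong₂ (λ x y → suc x + (suc y + 0)) (toℕ-code k xu j) (toℕ-code k yu j)) (collect N M _ _ _ _)) ⟩
    ∑[ j < N ] (N * (M * 4 + S (toℕ j)) + (2 + (τ xu (toℕ j) + τ yu (toℕ j))))
      ≡⟨ ∑-distrib-+ {N} (λ j → N * (M * 4 + S (toℕ j))) (λ j → 2 + (τ xu (toℕ j) + τ yu (toℕ j))) ⟩
    ∑[ j < N ] (N * (M * 4 + S (toℕ j))) + hubτ
      ≡⟨ cong (_+ hubτ) (*-distribˡ-sum {N} N (λ j → M * 4 + S (toℕ j))) ⟨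
    N * ∑[ j < N ] (M * 4 + S (toℕ j)) + hubτ
      ≡⟨ cong (λ x → N * x + hubτ) (∑-distrib-+ {N} (λ _ → M * 4) (S ∘ toℕ)) ⟩
    N * (∑[ j < N ] (M * 4) + ∑[ j < N ] S (toℕ j)) + hubτ
      ≡⟨ cong₂ (λ x y → N * (x + y) + hubτ) (sum-const N (M * 4)) (σ-hub-sum (toℕ≤r+r k)) ⟩
    value (fromℕ 2) ∎
    where
    open ≡-Reasoning
    S : ℕ → ℕ
    S j = σ xu j (toℕ k) + σ yu j (toℕ k)
    collect : ∀ N M σa σb τa τb →
      suc (N * (M * 0 + σa) + τa) + (suc (N * (M * 4 + σb) + τb) + 0) ≡ N * (M * 4 + (σa + σb)) + (2 + (τa + τb))
    collect = solve-∀
  hub-value k (suc zero) = trans (sum-cong-≗ {y = λ j → suc (toℕ (code k xu j)) + (suc (toℕ (code k yu j)) + 0)} λ j →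
      trans (cong₂ (λ x y → suc x + (suc y + 0)) (toℕ-code k xv j) (toℕ-code k yv j))
            (trans (swap N M _ _ _ _) (sym (cong₂ (λ x y → suc x + (suc y + 0)) (toℕ-code k xu j) (toℕ-code k yu j)))))
    (hub-value k zero)
    where
    swap : ∀ N M a b c d →
      suc (N * (M * 1 + a) + c) + (suc (N * (M * 3 + b) + d) + 0) ≡ suc (N * (M * 0 + b) + d) + (suc (N * (M * 4 + a) + c) + 0)
    swap = solve-∀

  wdeg-Join : ∀ k x → wdeg Join (weight k) x ≡ value (colour x)
  wdeg-Join k x with split (V Paths) 2 x
  ... | inˡ y = begin
    wdeg Join (weight k) (y ↑ˡ 2)
      ≡⟨ wdeg-∨ᴳˡ Paths (O 2) (weight k) y ⟩
    wdeg Paths (weight k ∘ innerEdge Paths (O 2) ∘ (_↑ˡ 0)) y + ∑[ b < 2 ] weight k (crossEdge Paths (O 2) y b)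
      ≡⟨ cong₂ _+_ path-part (sum-cong-≗ λ b → cong (suc ∘ toℕ ∘ uncurry (code k)) (edgeClass-across y b)) ⟩
    suc (toℕ (code k path j)) + ∑[ b < 2 ] suc (toℕ (code k (crossType side b) j))
      ≡⟨ path-vertex-value k j side ⟩
    value (inject₁ side)
      ≡⟨ cong value (colour-↑ˡ y) ⟨
    value (colour (y ↑ˡ 2)) ∎
    where
    open ≡-Reasoning
    j = proj₁ (copyOfᵛ P₂ N y)
    side = proj₂ (copyOfᵛ P₂ N y)
    path-part : wdeg Paths (weight k ∘ innerEdge Paths (O 2) ∘ (_↑ˡ 0)) y ≡ suc (toℕ (code k path j))
    path-part = begin
      wdeg Paths (weight k ∘ innerEdge Paths (O 2) ∘ (_↑ˡ 0)) y
        ≡⟨ wdeg-cong Paths y (λ a → cong (suc ∘ toℕ ∘ uncurry (code k)) (edgeClass-along a)) ⟩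
      wdeg Paths (uncurry (λ j _ → suc (toℕ (code k path j))) ∘ copyOfᵉ P₂ N) y
        ≡⟨ wdeg-copies P₂ N (λ j _ → suc (toℕ (code k path j))) y ⟩
      wdeg P₂ (λ _ → suc (toℕ (code k path j))) side
        ≡⟨ wdeg-P₂ _ side ⟩
      suc (toℕ (code k path j)) ∎
  ... | inʳ b = begin
    wdeg Join (weight k) (V Paths ↑ʳ b)
      ≡⟨ wdeg-∨ᴳʳ Paths (O 2) (weight k) b ⟩
    ∑[ y < V Paths ] weight k (crossEdge Paths (O 2) y b)
      ≡⟨ sum-cong-≗ (λ y → cong (suc ∘ toℕ ∘ uncurry (code k)) (edgeClass-across y b)) ⟩
    ∑[ y < V Paths ] uncurry (λ j side → suc (toℕ (code k (crossType side b) j))) (copyOfᵛ P₂ N y)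
      ≡⟨ sum-copies P₂ N (λ j side → suc (toℕ (code k (crossType side b) j))) ⟩
    ∑[ j < N ] ∑[ side < 2 ] suc (toℕ (code k (crossType side b) j))
      ≡⟨ hub-value k b ⟩
    value (fromℕ 2)
      ≡⟨ cong value (colour-↑ʳ b) ⟨
    value (colour (V Paths ↑ʳ b)) ∎
    where open ≡-Reasoning

  value₀<value₁ : value zero < value (suc zero)
  value₀<value₁ = subst (value zero <_) (sym (gap r t)) (m<m+n (value zero) z<s)
    where
    gap : ∀ r t → 3 + (2 * suc t + 1) * ((2 * r + 1) * 9 + (r + r + r)) + (suc t + suc t + suc t)
                ≡ 3 + (2 * suc t + 1) * ((2 * r + 1) * 3 + (r + r + r)) + (suc t + suc t + suc t)
                  + suc (24 * r * t + 12 * t + 36 * r + 17)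
    gap = solve-∀

  value₁<value₂ : value (suc zero) < value (suc (suc zero))
  value₁<value₂ = begin-strict
    value (suc zero)                                                                        <⟨ m<m+n (value (suc zero)) z<s ⟩
    value (suc zero) + suc (32 * r * t * t + 54 * r * t + 16 * t * t + 9 * r + 27 * t + 2)  ≡⟨ gap r t ⟨
    N * (N * (M * 4))                                                                       ≤⟨ *-monoʳ-≤ N (m≤m+n _ hubσ) ⟩
    N * (N * (M * 4) + hubσ)                                                                ≤⟨ m≤m+n _ hubτ ⟩
    value (suc (suc zero))                                                                  ∎
    where
    open ≤-Reasoning
    gap : ∀ r t → (2 * suc t + 1) * ((2 * suc t + 1) * ((2 * r + 1) * 4))
                ≡ 3 + (2 * suc t + 1) * ((2 * r + 1) * 9 + (r + r + r)) + (suc t + suc t + suc t)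
                  + suc (32 * r * t * t + 54 * r * t + 16 * t * t + 9 * r + 27 * t + 2)
    gap = solve-∀

  value-injective : Injective _≡_ _≡_ value
  value-injective {zero}           {zero}           _  = refl
  value-injective {zero}           {suc zero}       eq = contradiction eq (<⇒≢ value₀<value₁)
  value-injective {zero}           {suc (suc zero)} eq = contradiction eq (<⇒≢ (<-trans value₀<value₁ value₁<value₂))
  value-injective {suc zero}       {zero}           eq = contradiction (sym eq) (<⇒≢ value₀<value₁)
  value-injective {suc zero}       {suc zero}       _  = refl
  value-injective {suc zero}       {suc (suc zero)} eq = contradiction eq (<⇒≢ value₁<value₂)
  value-injective {suc (suc zero)} {zero}           eq = contradiction (sym eq) (<⇒≢ (<-trans value₀<value₁ value₁<value₂))
  value-injective {suc (suc zero)} {suc zero}       eq = contradiction (sym eq) (<⇒≢ value₁<value₂)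
  value-injective {suc (suc zero)} {suc (suc zero)} _  = refl

  colour-proper : Proper Join colour
  colour-proper = Proper-∨ᴳ Paths (O 2) (Proper-copies P₂ N {c = inject₁} λ _ ()) (λ ()) (λ _ _ → fromℕ≢inject₁ ∘ sym)

  path-vertex : ∀ side → ∃ λ x → colour x ≡ inject₁ side
  path-vertex side = let (y , y↦) = copyOfᵛ-surjective P₂ N zero side in
    y ↑ˡ 2 , trans (colour-↑ˡ y) (cong (inject₁ ∘ proj₂) y↦)

  colour-onto : ∀ i → ∃ λ x → colour x ≡ i
  colour-onto zero             = path-vertex zero
  colour-onto (suc zero)       = path-vertex (suc zero)
  colour-onto (suc (suc zero)) = V Paths ↑ʳ zero , colour-↑ʳ zero

  1≤M : 1 ≤ M
  1≤M = m≤n+m 1 (2 * r)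

  E-Whole : E Whole ≡ 5 * M * N
  E-Whole = begin
    E Whole                          ≡⟨ E-copies M Join ⟩
    M * (E Paths + 0 + V Paths * 2)  ≡⟨ cong₂ (λ e v → M * (e + 0 + v * 2)) (E-copies N P₂) (V-copies N P₂) ⟩
    M * (N * 1 + 0 + N * 2 * 2)      ≡⟨ count M N ⟩
    5 * M * N                        ∎
    where
    open ≡-Reasoning
    count : ∀ M N → M * (N * 1 + 0 + N * 2 * 2) ≡ 5 * M * N
    count = solve-∀

  edgeCode : Fin (E Whole) → Fin (5 * M * N)
  edgeCode = uncurry (λ k → uncurry (code k) ∘ edgeClass) ∘ copyOfᵉ Join M

  edgeCode-injective : Injective _≡_ _≡_ edgeCode
  edgeCode-injective eq with code-injective eq
  ... | k≡ , a≡ , j≡ = copyOfᵉ-injective Join M (×-≡,≡→≡ (k≡ , edgeClass-injective (×-≡,≡→≡ (a≡ , j≡))))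

  edgeCode-permutation : ∃ λ (π : Permutation′ (E Whole)) → ∀ e → toℕ (π ⟨$⟩ʳ e) ≡ toℕ (edgeCode e)
  edgeCode-permutation = injective⇒permutation (toℕ ∘ edgeCode) (edgeCode-injective ∘ toℕ-injective)
    (λ e → subst (toℕ (edgeCode e) <_) (sym E-Whole) (toℕ<n (edgeCode e)))

  π : Permutation′ (E Whole)
  π = proj₁ edgeCode-permutation

  wholeColour : Fin (V Whole) → Fin 3
  wholeColour = colour ∘ proj₂ ∘ copyOfᵛ Join M

  wholeColour-proper : Proper Whole wholeColour
  wholeColour-proper = Proper-copies Join M {c = colour} colour-proper

  vsum-π : ∀ v → vsum Whole π v ≡ value (wholeColour v)
  vsum-π v = begin
    vsum Whole π v                                           ≡⟨ vsum≡wdeg Whole π v ⟩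
    wdeg Whole (label Whole π) v                             ≡⟨ wdeg-cong Whole v (cong suc ∘ proj₂ edgeCode-permutation) ⟩
    wdeg Whole (uncurry weight ∘ copyOfᵉ Join M) v           ≡⟨ wdeg-copies Join M weight v ⟩
    uncurry (λ k → wdeg Join (weight k)) (copyOfᵛ Join M v)  ≡⟨ uncurry wdeg-Join (copyOfᵛ Join M v) ⟩
    value (wholeColour v)                                    ∎
    where open ≡-Reasoning

  wholeColour-onto : ∀ i → ∃ λ v → wholeColour v ≡ i
  wholeColour-onto i = let (x , x↦i) = colour-onto i ; (v , v↦x) = copyOfᵛ-surjective Join M (fromℕ< 1≤M) x in
    v , trans (cong (colour ∘ proj₂) v↦x) x↦i

  triangle : Triangle Whole
  triangle = Triangle-copies Join 1≤M (Triangle-∨ᴳ Paths (O 2) (Adjacent-⊕ˡ P₂ _ Adjacent-P₂) zero)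

χla-copies-join : ∀ r t → ChiLaIs (copies (2 * r + 1) (copies (2 * suc t + 1) P₂ ∨ᴳ O 2)) 3
χla-copies-join r t =
  ( π
  , LocalAntimagic-colouring Whole π wholeColour value value-injective vsum-π wholeColour-proper
  , numValues-colouring Whole π wholeColour value value-injective vsum-π wholeColour-onto )
  , λ π′ → 3≤numValues Whole π′ triangle
  where open Construction r t

corollary2p3 : ∀ (r s : ℕ) → 2 ≤ r → 2 ≤ s →
    ChiLaIs (copies (2 * r + 1) (copies (2 * s + 1) P₂ ∨ᴳ O 2)) 3
corollary2p3 r (suc t) _ _ = χla-copies-join r t
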